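{- Let $n,m\geq 2$ and consider the LC orbit of the complete bipartite graph $K_{n,m}$, where isomorphic graphs are identified. If $n\neq m$, then the number of isomorphism classes of graphs in $\mathcal{O}(K_{n,m})$ is $6$. If $n=m$, this number is $4$.
   Context: Local complement $c_v(G)$: replace the subgraph induced on the neighbourhood of vertex $v$ by its complement, leaving all other edges unchanged. The LC orbit $\mathcal{O}(G)$ of a labeled graph $G$ is the set of labeled graphs on the same vertex set obtainable from $G$ by finite sequences of local complements; $\mathcal{O}(G)/\cong$ denotes this set modulo graph isomorphism. -}

module Defs where

open import Data.Nat using (ℕ; _+_; _<ᵇ_)
open import Data.Fin using (Fin; toℕ; _≟_)
open import Data.Bool using (Bool; true; false; not; _∧_; _∨_; if_then_else_)
open import Data.List using (List; foldr)
open import Data.Product using (Σ; ∃; _×_)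
open import Relation.Nullary using (¬_)
open import Relation.Nullary.Decidable using (⌊_⌋)
open import Relation.Binary.PropositionalEquality using (_≡_)
open import Function.Bundles using (_↔_; Inverse)

-- A (labeled, simple) graph on vertex set Fin N, given by its adjacency
-- function.  All graphs considered below (members of an LC orbit of a
-- simple graph) are symmetric and irreflexive.
Graph : ℕ → Set
Graph N = Fin N → Fin N → Bool

lc : ∀ {N} → Fin N → Graph N → Graph N
lc v G u w =
  if G v u ∧ G v w ∧ not ⌊ u ≟ w ⌋ then not (G u w) else G u w

lcs : ∀ {N} → List (Fin N) → Graph N → Graph N
lcs vs G = foldr lc G vs

_≐_ : ∀ {N} → Graph N → Graph N → Set
G ≐ H = ∀ u w → G u w ≡ H u w

InOrbit : ∀ {N} → Graph N → Graph N → Set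
InOrbit G H = Σ (List (Fin _)) λ vs → lcs vs G ≐ H

_≅_ : ∀ {N} → Graph N → Graph N → Set
_≅_ {N} G H = Σ (Fin N ↔ Fin N) λ π →
  ∀ u w → G u w ≡ H (Inverse.to π u) (Inverse.to π w)

NumIsoClasses : ∀ {N} → (Graph N → Set) → ℕ → Set
NumIsoClasses {N} P k = Σ (Fin k → Graph N) λ rep →
  (∀ i → P (rep i)) ×
  (∀ i j → rep i ≅ rep j → i ≡ j) ×
  (∀ H → P H → ∃ λ i → H ≅ rep i)

inFirst : ∀ n {m} → Fin (n + m) → Bool
inFirst n u = toℕ u <ᵇ n

K : ∀ n m → Graph (n + m)
K n m u w = (not (inFirst n u) ∧ inFirst n w) ∨ (inFirst n u ∧ not (inFirst n w))

-- Fix anchors a ∈ A and b ∈ B and colour every vertex by its class: {a}, {b}, A ∖ {a} or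
-- B ∖ {b}.  Every graph in the LC orbit of K_{n,m} is, for suitable anchors, the graph in which
-- adjacency of distinct vertices is a function of their classes, for one of six such functions
-- ("kinds"): K_{n,m} itself, A or B turned into a clique, a or b made universal over a clique on
-- the other side, and the double star.  Local complementation acts on the kinds through a finite
-- transition table, which is computed on the four classes; at a vertex of A ∖ {a} one first moves
-- the anchor a there, which changes nothing for the kinds that do not single out a.  Moving the
-- anchors is a relabelling, so there are at most six classes, and when n = m swapping the two sides
-- identifies each A-kind with its B-twin.  Existence of a universal vertex, of an edge between
-- non-universal vertices, and of a leaf tell the remaining kinds apart; in each pair of twins the
-- universal vertices (resp. the endpoints of edges between non-universal vertices) form exactly
-- one side, so an isomorphism between twins maps A onto B and forces n = m.
module Submission where

open import Defs
open import Data.Bool using (Bool; true; false; not; _∧_; _∨_; _xor_; if_then_else_)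
import Data.Bool.Properties as Bool
open import Data.Empty using (⊥-elim)
open import Data.Fin using (Fin; zero; suc; _≟_; toℕ; _↑ˡ_; _↑ʳ_; splitAt)
open import Data.Fin.Patterns using (0F; 1F; 2F; 3F)
open import Data.Fin.Permutation
  using (Permutation′; _⟨$⟩ʳ_; _⟨$⟩ˡ_; inverseˡ; inverseʳ; flip; id; _∘ₚ_)
import Data.Fin.Permutation as Perm
open import Data.Fin.Properties
  using (all?; any?; +↔⊎; toℕ<n; toℕ-↑ˡ; toℕ-↑ʳ; ↑ˡ-injective; ↑ʳ-injective;
         splitAt⁻¹-↑ˡ; splitAt⁻¹-↑ʳ; injective⇒≤)
open import Data.List using (List; []; _∷_; map; foldr)
open import Data.List.Relation.Unary.All as All using (All; []; _∷_)
open import Data.Nat using (ℕ; suc; _+_; _<ᵇ_; _≥_; s≤s; z≤n)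
open import Data.Nat.Properties using (<⇒<ᵇ; <ᵇ⇒<; m+n≮m; ≤-antisym)
open import Data.Product using (_×_; _,_; ∃; proj₁; proj₂)
open import Data.Product.Properties using (≡-dec)
open import Data.Sum using (_⊎_; inj₁; inj₂; map₂; [_,_]′)
open import Data.Sum.Properties using (swap-↔)
open import Function.Base using (_∘_; case_of_)
open import Function.Bundles using (_⇔_; mk⇔; Equivalence; Injection)
open import Function.Construct.Composition using (_⇔-∘_)
open import Function.Construct.Symmetry using (⇔-sym)
open import Function.Properties.Inverse using (↔⇒↣; ↔-trans; ↔-sym)
open import Relation.Nullary using (Dec; does; ¬_; yes; no)
open import Relation.Nullary.Decidable
  using (⌊_⌋; dec-true; dec-false; does-⇔; from-yes; map′; _×-dec_; _⊎-dec_; _→-dec_; ¬?)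
open import Relation.Binary.PropositionalEquality
  using (_≡_; _≢_; refl; sym; trans; cong; cong₂; subst; module ≡-Reasoning)

module _ {N : ℕ} where

  ≐-sym : {G H : Graph N} → G ≐ H → H ≐ G
  ≐-sym G≐H u w = sym (G≐H u w)

  ≐-trans : {G H J : Graph N} → G ≐ H → H ≐ J → G ≐ J
  ≐-trans G≐H H≐J u w = trans (G≐H u w) (H≐J u w)

  lc-cong : ∀ v {G H : Graph N} → G ≐ H → lc v G ≐ lc v H
  lc-cong v {G} {H} G≐H u w rewrite G≐H v u | G≐H v w | G≐H u w = refl

  ≐⇒≅ : {G H : Graph N} → G ≐ H → G ≅ H
  ≐⇒≅ G≐H = id , G≐H

  ≅-sym : {G H : Graph N} → G ≅ H → H ≅ G
  ≅-sym {G} {H} (π , G≅H) = flip π , λ u w →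
    trans (cong₂ H (sym (inverseʳ π)) (sym (inverseʳ π))) (sym (G≅H (π ⟨$⟩ˡ u) (π ⟨$⟩ˡ w)))

  ≅-trans : {G H J : Graph N} → G ≅ H → H ≅ J → G ≅ J
  ≅-trans (π , G≅H) (ρ , H≅J) = π ∘ₚ ρ , λ u w →
    trans (G≅H u w) (H≅J (π ⟨$⟩ʳ u) (π ⟨$⟩ʳ w))

  ≅-adjacent : {G H : Graph N} ((π , _) : G ≅ H) → ∀ u w → H (π ⟨$⟩ʳ u) w ≡ G u (π ⟨$⟩ˡ w)
  ≅-adjacent {G} {H} (π , G≅H) u w =
    trans (cong (H (π ⟨$⟩ʳ u)) (sym (inverseʳ π))) (sym (G≅H u (π ⟨$⟩ˡ w)))

transpose-source : ∀ {N} (i j : Fin N) → Perm.transpose i j ⟨$⟩ʳ i ≡ j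
transpose-source i j rewrite dec-true (i ≟ i) refl = refl

transpose-other : ∀ {N} {i j k : Fin N} → k ≢ i → k ≢ j → Perm.transpose i j ⟨$⟩ʳ k ≡ k
transpose-other {i = i} {j} {k} k≢i k≢j rewrite dec-false (k ≟ i) k≢i | dec-false (k ≟ j) k≢j = refl

transpose-preserves : ∀ {N} {A : Set} (f : Fin N → A) {i j} → f i ≡ f j →
  ∀ k → f (Perm.transpose i j ⟨$⟩ʳ k) ≡ f k
transpose-preserves f {i} {j} fi≡fj k with k ≟ i
... | yes refl = sym fi≡fj
... | no _ with k ≟ j
...   | yes refl = fi≡fj
...   | no _     = refl

-- Graphs whose adjacency is a function of vertex colours

lcᶜ : {C : Set} → C → (C → C → Bool) → C → C → Bool
lcᶜ z f x y = if f z x ∧ f z y then not (f x y) else f x y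

module _ {N : ℕ} {C : Set} where

  colourGraph : (Fin N → C) → (C → C → Bool) → Graph N
  colourGraph c f u w = not ⌊ u ≟ w ⌋ ∧ f (c u) (c w)

  module _ {c : Fin N → C} {f : C → C → Bool} where

    colourGraph-off : ∀ {u w} → u ≢ w → colourGraph c f u w ≡ f (c u) (c w)
    colourGraph-off {u} {w} u≢w with u ≟ w
    ... | yes u≡w = ⊥-elim (u≢w u≡w)
    ... | no _    = refl

    colourGraph-edge : ∀ {u w} → colourGraph c f u w ≡ true → u ≢ w × f (c u) (c w) ≡ true
    colourGraph-edge {u} {w} uw with u ≟ w
    ... | no u≢w = u≢w , uw

    colourGraph-loopless : ∀ v u → f (c v) (c v) ≡ false → colourGraph c f v u ≡ f (c v) (c u)
    colourGraph-loopless v u loopless with v ≟ u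
    ... | yes refl = sym loopless
    ... | no _     = refl

  colourGraph-≐ : ∀ {c c′ f f′} → (∀ {u w} → u ≢ w → f (c u) (c w) ≡ f′ (c′ u) (c′ w)) →
    colourGraph c f ≐ colourGraph c′ f′
  colourGraph-≐ agree u w with u ≟ w
  ... | yes _   = refl
  ... | no u≢w = agree u≢w

  colourGraph-≅ : ∀ {c c′ f f′} (π : Permutation′ N) (τ : C → C) →
    (∀ u → c′ (π ⟨$⟩ʳ u) ≡ τ (c u)) → (∀ x y → f′ (τ x) (τ y) ≡ f x y) →
    colourGraph c f ≅ colourGraph c′ f′
  colourGraph-≅ {c} {c′} {f} {f′} π τ recolour respects = π , λ u w → begin
      not ⌊ u ≟ w ⌋ ∧ f (c u) (c w)
    ≡⟨ cong₂ (λ p q → not p ∧ q) (sym (≟-image u w)) (sym (respects (c u) (c w))) ⟩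
      not ⌊ π ⟨$⟩ʳ u ≟ π ⟨$⟩ʳ w ⌋ ∧ f′ (τ (c u)) (τ (c w))
    ≡⟨ cong₂ (λ x y → not ⌊ π ⟨$⟩ʳ u ≟ π ⟨$⟩ʳ w ⌋ ∧ f′ x y)
             (sym (recolour u)) (sym (recolour w)) ⟩
      not ⌊ π ⟨$⟩ʳ u ≟ π ⟨$⟩ʳ w ⌋ ∧ f′ (c′ (π ⟨$⟩ʳ u)) (c′ (π ⟨$⟩ʳ w))
    ∎
    where
    open ≡-Reasoning
    ≟-image : ∀ u w → ⌊ π ⟨$⟩ʳ u ≟ π ⟨$⟩ʳ w ⌋ ≡ ⌊ u ≟ w ⌋
    ≟-image u w with u ≟ w | π ⟨$⟩ʳ u ≟ π ⟨$⟩ʳ w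
    ... | yes _   | yes _    = refl
    ... | no _    | no _     = refl
    ... | yes u≡w | no πu≢πw = ⊥-elim (πu≢πw (cong (π ⟨$⟩ʳ_) u≡w))
    ... | no u≢w  | yes πu≡πw = ⊥-elim (u≢w (Injection.injective (↔⇒↣ π) πu≡πw))

  -- The hypothesis on f (c v) (c v) makes the class-level neighbourhood of c v agree with the
  -- neighbourhood of v, which never contains v itself.
  lc-colourGraph : ∀ {c f f′} v → f (c v) (c v) ≡ false →
    (∀ {u w} → u ≢ w → lcᶜ (c v) f (c u) (c w) ≡ f′ (c u) (c w)) →
    lc v (colourGraph c f) ≐ colourGraph c f′
  lc-colourGraph {c} {f} {f′} v loopless complements u w with u ≟ w
  ... | yes refl = cong (λ b → if b then true else false)
      (trans (cong (G v u ∧_) (Bool.∧-zeroʳ (G v u))) (Bool.∧-zeroʳ (G v u)))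
    where G = colourGraph c f
  ... | no u≢w = begin
      (if G v u ∧ G v w ∧ true then not (f (c u) (c w)) else f (c u) (c w))
    ≡⟨ cong (λ b → if b then not (f (c u) (c w)) else f (c u) (c w))
         (cong₂ _∧_ (colourGraph-loopless {c = c} {f} v u loopless)
                    (trans (Bool.∧-identityʳ _) (colourGraph-loopless {c = c} {f} v w loopless))) ⟩
      lcᶜ (c v) f (c u) (c w)
    ≡⟨ complements u≢w ⟩
      f′ (c u) (c w)
    ∎
    where
    open ≡-Reasoning
    G = colourGraph c f

-- Isomorphism-invariant vertex properties

module _ {N : ℕ} where

  Universal : Graph N → Fin N → Set
  Universal G u = ∀ w → u ≢ w → G u w ≡ true

  OnInnerEdge : Graph N → Fin N → Set
  OnInnerEdge G u = ¬ Universal G u × ∃ λ w → G u w ≡ true × ¬ Universal G w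

  Leaf : Graph N → Fin N → Set
  Leaf G u = ∃ λ w → G u w ≡ true × ∀ x → G u x ≡ true → x ≡ w

  record Invariant (P : Graph N → Fin N → Set) : Set where
    field transport : ∀ {G H} (iso : G ≅ H) {u} → P G u → P H (proj₁ iso ⟨$⟩ʳ u)

  module _ {P : Graph N → Fin N → Set} (invariant : Invariant P) {G H : Graph N} (iso : G ≅ H) where
    private
      π = proj₁ iso
      open Invariant invariant

    invariant-reflect : ∀ {u} → P H (π ⟨$⟩ʳ u) → P G u
    invariant-reflect p = subst (P G) (inverseˡ π) (transport (≅-sym {G = G} {H} iso) p)

    invariant-⇔ : ∀ u → P G u ⇔ P H (π ⟨$⟩ʳ u)
    invariant-⇔ u = mk⇔ (transport iso) invariant-reflect

    ∃-invariant : ∃ (P G) ⇔ ∃ (P H)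
    ∃-invariant = mk⇔ (λ (u , p) → π ⟨$⟩ʳ u , transport iso p)
                      (λ (v , p) → π ⟨$⟩ˡ v , transport (≅-sym {G = G} {H} iso) p)

  universal-invariant : Invariant Universal
  universal-invariant .Invariant.transport {G} {H} iso@(π , _) {u} U w πu≢w =
    trans (≅-adjacent {G = G} {H} iso u w)
          (U (π ⟨$⟩ˡ w) λ u≡π⁻¹w → πu≢w (trans (cong (π ⟨$⟩ʳ_) u≡π⁻¹w) (inverseʳ π)))

  onInnerEdge-invariant : Invariant OnInnerEdge
  onInnerEdge-invariant .Invariant.transport {G} {H} iso@(π , G≅H) {u} (¬U , w , uw , ¬Uw) =
    ¬U ∘ invariant-reflect universal-invariant {G} {H} iso ,
    π ⟨$⟩ʳ w , trans (sym (G≅H u w)) uw , ¬Uw ∘ invariant-reflect universal-invariant {G} {H} iso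

  leaf-invariant : Invariant Leaf
  leaf-invariant .Invariant.transport {G} {H} iso@(π , G≅H) {u} (w , uw , unique) =
    π ⟨$⟩ʳ w , trans (sym (G≅H u w)) uw , λ x πu-x →
      trans (sym (inverseʳ π))
            (cong (π ⟨$⟩ʳ_) (unique (π ⟨$⟩ˡ x) (trans (sym (≅-adjacent {G = G} {H} iso u x)) πu-x)))

-- Classes and kinds

-- α = {a}, β = {b}, A′ = A ∖ {a}, B′ = B ∖ {b}.  Classes and kinds are encoded as Fin 4 and
-- Fin 6 so that every statement about them is decided by evaluating all? and any?.
Class : Set
Class = Fin 4

pattern α  = zero
pattern β  = suc zero
pattern A′ = suc (suc zero)
pattern B′ = suc (suc (suc zero))

isA : Class → Bool
isA α  = true
isA β  = false
isA A′ = true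
isA B′ = false

sideClass : Bool → Class
sideClass true  = A′
sideClass false = B′

singleton : Class → Bool
singleton α  = true
singleton β  = true
singleton A′ = false
singleton B′ = false

-- Two distinct vertices can have the classes x and y.
realisable : Class → Class → Bool
realisable x y = not (singleton x ∧ ⌊ x ≟ y ⌋)

_is_ : Class → Class → Bool
x is y = ⌊ x ≟ y ⌋

mirrorClass : Class → Class
mirrorClass α  = β
mirrorClass β  = α
mirrorClass A′ = B′
mirrorClass B′ = A′

mergeA : Class → Class
mergeA α = A′
mergeA x = x

mergeB : Class → Class
mergeB β = B′
mergeB x = x

Kind : Set
Kind = Fin 6

pattern complete   = zero
pattern splitA     = suc zero
pattern splitB     = suc (suc zero)
pattern coneA      = suc (suc (suc zero))
pattern coneB      = suc (suc (suc (suc zero)))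
pattern doubleStar = suc (suc (suc (suc (suc zero))))

doubleStarArc : Class → Class → Bool
doubleStarArc α β  = true
doubleStarArc α A′ = true
doubleStarArc β B′ = true
doubleStarArc _ _  = false

-- splitA: the clique A joined to the independent set B;  coneA: a joined to everything and
-- B a clique;  doubleStar: the edge ab with leaves A′ at a and B′ at b.
edge : Kind → Class → Class → Bool
edge complete   x y = isA x xor isA y
edge splitA     x y = isA x ∨ isA y
edge splitB     x y = not (isA x ∧ isA y)
edge coneA      x y = x is α ∨ y is α ∨ not (isA x ∨ isA y)
edge coneB      x y = x is β ∨ y is β ∨ (isA x ∧ isA y)
edge doubleStar x y = doubleStarArc x y ∨ doubleStarArc y x

adj : Kind → Class → Class → Bool
adj k x y = realisable x y ∧ edge k x y

mirror : Kind → Kind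
mirror splitA = splitB
mirror splitB = splitA
mirror coneA  = coneB
mirror coneB  = coneA
mirror k      = k

lcKind : Kind → Class → Kind
lcKind complete   α  = splitB
lcKind complete   β  = splitA
lcKind complete   A′ = splitB
lcKind complete   B′ = splitA
lcKind splitA     α  = coneA
lcKind splitA     β  = complete
lcKind splitA     A′ = coneA
lcKind splitA     B′ = complete
lcKind splitB     α  = complete
lcKind splitB     β  = coneB
lcKind splitB     A′ = complete
lcKind splitB     B′ = coneB
lcKind coneA      α  = splitA
lcKind coneA      β  = doubleStar
lcKind coneA      A′ = coneA
lcKind coneA      B′ = doubleStar
lcKind coneB      α  = doubleStar
lcKind coneB      β  = splitB
lcKind coneB      A′ = doubleStar
lcKind coneB      B′ = coneB
lcKind doubleStar α  = coneB
lcKind doubleStar β  = coneA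
lcKind doubleStar A′ = doubleStar
lcKind doubleStar B′ = doubleStar

record Step (k : Kind) (z : Class) (k′ : Kind) : Set where
  constructor step
  field
    loopless    : adj k z z ≡ false
    complements : ∀ x y → realisable x y ≡ true → lcᶜ z (adj k) x y ≡ adj k′ x y

step? : ∀ k z k′ → Dec (Step k z k′)
step? k z k′ = map′ (λ (l , c) → step l c) (λ (step l c) → l , c) ((adj k z z Bool.≟ false) ×-dec
  all? λ x → all? λ y → (realisable x y Bool.≟ true) →-dec (lcᶜ z (adj k) x y Bool.≟ adj k′ x y))

record Blind (φ : Class → Class) (k : Kind) : Set where
  constructor blind
  field unchanged : ∀ x y → realisable x y ≡ true → adj k x y ≡ adj k (φ x) (φ y)

blind? : ∀ φ k → Dec (Blind φ k)
blind? φ k = map′ blind Blind.unchanged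
  (all? λ x → all? λ y → (realisable x y Bool.≟ true) →-dec (adj k x y Bool.≟ adj k (φ x) (φ y)))

UniversalClass : Kind → Class → Set
UniversalClass k x = ∀ y → x ≢ y → adj k x y ≡ true

universal? : ∀ k x → Dec (UniversalClass k x)
universal? k x = all? λ y → ¬? (x ≟ y) →-dec (adj k x y Bool.≟ true)

InnerClass : Kind → Class → Set
InnerClass k x = ¬ UniversalClass k x × ∃ λ y → adj k x y ≡ true × ¬ UniversalClass k y

inner? : ∀ k x → Dec (InnerClass k x)
inner? k x = ¬? (universal? k x) ×-dec any? λ y → (adj k x y Bool.≟ true) ×-dec ¬? (universal? k y)

_⇔?_ : {A B : Set} → Dec A → Dec B → Dec (A ⇔ B)
a? ⇔? b? = map′ (λ (f , g) → mk⇔ f g) (λ e → Equivalence.to e , Equivalence.from e)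
  ((a? →-dec b?) ×-dec (b? →-dec a?))

profile : Kind → Bool × Bool
profile k = does (any? (universal? k)) , does (any? (inner? k))

Lookalike : Kind → Kind → Set
Lookalike k k′ =
  (k′ ≡ mirror k × k′ ≢ k) ⊎ (k ≡ complete × k′ ≡ doubleStar) ⊎ (k ≡ doubleStar × k′ ≡ complete)

lookalike? : ∀ k k′ → Dec (Lookalike k k′)
lookalike? k k′ = ((k′ ≟ mirror k) ×-dec ¬? (k′ ≟ k)) ⊎-dec
  ((k ≟ complete) ×-dec (k′ ≟ doubleStar)) ⊎-dec ((k ≟ doubleStar) ×-dec (k′ ≟ complete))

balanced : Fin 4 → Kind
balanced 0F = complete
balanced 1F = splitA
balanced 2F = coneA
balanced 3F = doubleStar

-- Opaque, so that the decision procedures behind these facts are never unfolded where they are used.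
opaque
  anchor-steps : ∀ k z → singleton z ≡ true → Step k z (lcKind k z)
  anchor-steps = from-yes (all? λ k → all? λ z → (singleton z Bool.≟ true) →-dec step? k z (lcKind k z))

  -- At a vertex of A′ either the kind does not single out a, so the vertex may become the anchor,
  -- or the step is computed directly.
  A′-steps : ∀ k → (Blind mergeA k × lcKind k A′ ≡ lcKind k α) ⊎ Step k A′ (lcKind k A′)
  A′-steps = from-yes (all? λ k →
    (blind? mergeA k ×-dec (lcKind k A′ ≟ lcKind k α)) ⊎-dec step? k A′ (lcKind k A′))

  B′-steps : ∀ k → (Blind mergeB k × lcKind k B′ ≡ lcKind k β) ⊎ Step k B′ (lcKind k B′)
  B′-steps = from-yes (all? λ k →
    (blind? mergeB k ×-dec (lcKind k B′ ≟ lcKind k β)) ⊎-dec step? k B′ (lcKind k B′))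

  mirror-adj : ∀ k x y → adj (mirror k) (mirrorClass x) (mirrorClass y) ≡ adj k x y
  mirror-adj = from-yes (all? λ k → all? λ x → all? λ y →
    adj (mirror k) (mirrorClass x) (mirrorClass y) Bool.≟ adj k x y)

  universal-closed : ∀ k x → UniversalClass k x → realisable x x ≡ true → adj k x x ≡ true
  universal-closed = from-yes (all? λ k → all? λ x →
    universal? k x →-dec ((realisable x x Bool.≟ true) →-dec (adj k x x Bool.≟ true)))

  inner-distinct : ∀ k x → InnerClass k x → ∃ λ y → x ≢ y × adj k x y ≡ true × ¬ UniversalClass k y
  inner-distinct = from-yes (all? λ k → all? λ x →
    inner? k x →-dec any? λ y → ¬? (x ≟ y) ×-dec (adj k x y Bool.≟ true) ×-dec ¬? (universal? k y))

  universal-splitA : ∀ x → UniversalClass splitA x ⇔ isA x ≡ true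
  universal-splitA = from-yes (all? λ x → universal? splitA x ⇔? (isA x Bool.≟ true))

  universal-splitB : ∀ x → UniversalClass splitB x ⇔ isA x ≡ false
  universal-splitB = from-yes (all? λ x → universal? splitB x ⇔? (isA x Bool.≟ false))

  inner-coneA : ∀ x → InnerClass coneA x ⇔ isA x ≡ false
  inner-coneA = from-yes (all? λ x → inner? coneA x ⇔? (isA x Bool.≟ false))

  inner-coneB : ∀ x → InnerClass coneB x ⇔ isA x ≡ true
  inner-coneB = from-yes (all? λ x → inner? coneB x ⇔? (isA x Bool.≟ true))

  same-profile : ∀ k k′ → profile k ≡ profile k′ → k′ ≡ k ⊎ Lookalike k k′
  same-profile = from-yes (all? λ k → all? λ k′ →
    ≡-dec Bool._≟_ Bool._≟_ (profile k) (profile k′) →-dec ((k′ ≟ k) ⊎-dec lookalike? k k′))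

  doubleStar-A′-neighbours : ∀ y → adj doubleStar A′ y ≡ true → y ≡ α
  doubleStar-A′-neighbours = from-yes (all? λ y → (adj doubleStar A′ y Bool.≟ true) →-dec (y ≟ α))

  complete-two-neighbours : ∀ x → ∃ λ y → ∃ λ z →
    y ≢ z × x ≢ y × x ≢ z × adj complete x y ≡ true × adj complete x z ≡ true
  complete-two-neighbours = from-yes (all? λ x → any? λ y → any? λ z →
    ¬? (y ≟ z) ×-dec ¬? (x ≟ y) ×-dec ¬? (x ≟ z) ×-dec
    (adj complete x y Bool.≟ true) ×-dec (adj complete x z Bool.≟ true))

  balanced-separated : ∀ i j → balanced j ≡ balanced i ⊎ balanced j ≡ mirror (balanced i) → i ≡ j
  balanced-separated = from-yes (all? λ i → all? λ j →
    ((balanced j ≟ balanced i) ⊎-dec (balanced j ≟ mirror (balanced i))) →-dec (i ≟ j))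

  balanced-covers : ∀ k → ∃ λ i → k ≡ balanced i ⊎ mirror k ≡ balanced i
  balanced-covers = from-yes (all? λ k → any? λ i → (k ≟ balanced i) ⊎-dec (mirror k ≟ balanced i))

module Bipartition (n m : ℕ) where

  side : Fin (n + m) → Bool
  side = inFirst n

  side-↑ˡ : ∀ i → side (i ↑ˡ m) ≡ true
  side-↑ˡ i rewrite toℕ-↑ˡ i m = Equivalence.to Bool.T-≡ (<⇒<ᵇ (toℕ<n i))

  side-↑ʳ : ∀ j → side (n ↑ʳ j) ≡ false
  side-↑ʳ j rewrite toℕ-↑ʳ n j =
    Bool.¬-not λ e → m+n≮m n (toℕ j) (<ᵇ⇒< _ _ (Equivalence.from Bool.T-≡ e))

  sides-differ : ∀ {u w} → side u ≡ true → side w ≡ false → u ≢ w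
  sides-differ su sw refl with trans (sym su) sw
  ... | ()

  fromA : ∀ u → side u ≡ true → ∃ λ i → i ↑ˡ m ≡ u
  fromA u su with splitAt n u in eq
  ... | inj₁ i = i , splitAt⁻¹-↑ˡ eq
  ... | inj₂ j = ⊥-elim (sides-differ su (side-↑ʳ j) (sym (splitAt⁻¹-↑ʳ eq)))

  fromB : ∀ u → side u ≡ false → ∃ λ j → n ↑ʳ j ≡ u
  fromB u su with splitAt n u in eq
  ... | inj₁ i = ⊥-elim (sides-differ (side-↑ˡ i) su (splitAt⁻¹-↑ˡ eq))
  ... | inj₂ j = j , splitAt⁻¹-↑ʳ eq

  sides-swapped⇒n≡m : (π : Permutation′ (n + m)) → (∀ u → side (π ⟨$⟩ʳ u) ≡ not (side u)) →
    n ≡ m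
  sides-swapped⇒n≡m π swaps =
    ≤-antisym (injective⇒≤ {f = A→B} A→B-injective) (injective⇒≤ {f = B→A} B→A-injective)
    where
    open ≡-Reasoning
    π-injective = Injection.injective (↔⇒↣ π)
    A→B : Fin n → Fin m
    A→B i = proj₁ (fromB _ (trans (swaps (i ↑ˡ m)) (cong not (side-↑ˡ i))))
    A→B-injective : ∀ {i i′} → A→B i ≡ A→B i′ → i ≡ i′
    A→B-injective {i} {i′} e = ↑ˡ-injective m i i′ (π-injective (begin
        π ⟨$⟩ʳ (i ↑ˡ m)   ≡⟨ sym (proj₂ (fromB _ _)) ⟩
        n ↑ʳ A→B i         ≡⟨ cong (n ↑ʳ_) e ⟩
        n ↑ʳ A→B i′        ≡⟨ proj₂ (fromB _ _) ⟩
        π ⟨$⟩ʳ (i′ ↑ˡ m)  ∎))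
    B→A : Fin m → Fin n
    B→A j = proj₁ (fromA _ (trans (swaps (n ↑ʳ j)) (cong not (side-↑ʳ j))))
    B→A-injective : ∀ {j j′} → B→A j ≡ B→A j′ → j ≡ j′
    B→A-injective {j} {j′} e = ↑ʳ-injective n j j′ (π-injective (begin
        π ⟨$⟩ʳ (n ↑ʳ j)   ≡⟨ sym (proj₂ (fromA _ _)) ⟩
        B→A j ↑ˡ m         ≡⟨ cong (_↑ˡ m) e ⟩
        B→A j′ ↑ˡ m        ≡⟨ proj₂ (fromA _ _) ⟩
        π ⟨$⟩ʳ (n ↑ʳ j′)  ∎))

  record Anchors : Set where
    constructor anchors
    field
      a b : Fin (n + m)
      a∈A : side a ≡ true
      b∈B : side b ≡ false
  open Anchors

  colour : Anchors → Fin (n + m) → Class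
  colour p u = if ⌊ u ≟ a p ⌋ then α else if ⌊ u ≟ b p ⌋ then β else sideClass (side u)

  graphOf : Kind → Anchors → Graph (n + m)
  graphOf k p = colourGraph (colour p) (adj k)

  moveA : Anchors → ∀ v → side v ≡ true → Anchors
  moveA p v v∈A = record p { a = v ; a∈A = v∈A }

  moveB : Anchors → ∀ v → side v ≡ false → Anchors
  moveB p v v∈B = record p { b = v ; b∈B = v∈B }

  module _ (p : Anchors) where

    colour-a : colour p (a p) ≡ α
    colour-a with a p ≟ a p
    ... | yes _   = refl
    ... | no a≢a = ⊥-elim (a≢a refl)

    colour-b : colour p (b p) ≡ β
    colour-b with b p ≟ a p | b p ≟ b p
    ... | yes b≡a | _       = ⊥-elim (sides-differ (a∈A p) (b∈B p) (sym b≡a))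
    ... | no _    | yes _   = refl
    ... | no _    | no b≢b = ⊥-elim (b≢b refl)

    colour-other : ∀ {u} → u ≢ a p → u ≢ b p → colour p u ≡ sideClass (side u)
    colour-other {u} u≢a u≢b with u ≟ a p | u ≟ b p
    ... | yes u≡a | _       = ⊥-elim (u≢a u≡a)
    ... | no _    | yes u≡b = ⊥-elim (u≢b u≡b)
    ... | no _    | no _    = refl

    isA-colour : ∀ u → isA (colour p u) ≡ side u
    isA-colour u with u ≟ a p
    ... | yes refl = sym (a∈A p)
    ... | no _ with u ≟ b p
    ...   | yes refl = sym (b∈B p)
    ...   | no _     = isA-sideClass (side u)
      where
      isA-sideClass : ∀ s → isA (sideClass s) ≡ s
      isA-sideClass true  = refl
      isA-sideClass false = refl

    colour≡α : ∀ {u} → colour p u ≡ α → u ≡ a p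
    colour≡α {u} e with u ≟ a p
    ... | yes u≡a = u≡a
    ... | no _ with u ≟ b p
    colour≡α () | no _ | yes _
    ...   | no _ with side u
    colour≡α () | no _ | no _ | true
    colour≡α () | no _ | no _ | false

    colour≡β : ∀ {u} → colour p u ≡ β → u ≡ b p
    colour≡β {u} e with u ≟ a p
    colour≡β () | yes _
    ... | no _ with u ≟ b p
    ...   | yes u≡b = u≡b
    ...   | no _ with side u
    colour≡β () | no _ | no _ | true
    colour≡β () | no _ | no _ | false

    colour-realisable : ∀ {u w} → u ≢ w → realisable (colour p u) (colour p w) ≡ true
    colour-realisable {u} {w} u≢w with colour p u in eu
    ... | A′ = refl
    ... | B′ = refl
    ... | α with colour p w in ew
    ...   | α  = ⊥-elim (u≢w (trans (colour≡α eu) (sym (colour≡α ew))))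
    ...   | β  = refl
    ...   | A′ = refl
    ...   | B′ = refl
    colour-realisable {u} {w} u≢w | β with colour p w in ew
    ...   | α  = refl
    ...   | β  = ⊥-elim (u≢w (trans (colour≡β eu) (sym (colour≡β ew))))
    ...   | A′ = refl
    ...   | B′ = refl

    mergeA-colour : ∀ u → mergeA (colour p u) ≡ (if ⌊ u ≟ b p ⌋ then β else sideClass (side u))
    mergeA-colour u with u ≟ a p
    ... | yes refl with u ≟ b p
    ...   | yes u≡b = ⊥-elim (sides-differ (a∈A p) (b∈B p) u≡b)
    ...   | no _    rewrite a∈A p = refl
    mergeA-colour u | no _ with u ≟ b p
    ...   | yes _ = refl
    ...   | no _ with side u
    ...     | true  = refl
    ...     | false = refl

    mergeB-colour : ∀ u → mergeB (colour p u) ≡ (if ⌊ u ≟ a p ⌋ then α else sideClass (side u))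
    mergeB-colour u with u ≟ a p
    ... | yes _ = refl
    ... | no _ with u ≟ b p
    ...   | yes refl rewrite b∈B p = refl
    ...   | no _ with side u
    ...     | true  = refl
    ...     | false = refl

  reanchor : ∀ {φ k} p q → Blind φ k → (∀ u → φ (colour p u) ≡ φ (colour q u)) →
    graphOf k p ≐ graphOf k q
  reanchor {φ} {k} p q (blind unchanged) same =
    colourGraph-≐ {c = colour p} {colour q} {adj k} {adj k} λ {u} {w} u≢w → begin
      adj k (colour p u) (colour p w)
    ≡⟨ unchanged _ _ (colour-realisable p u≢w) ⟩
      adj k (φ (colour p u)) (φ (colour p w))
    ≡⟨ cong₂ (adj k) (same u) (same w) ⟩
      adj k (φ (colour q u)) (φ (colour q w))
    ≡⟨ sym (unchanged _ _ (colour-realisable q u≢w)) ⟩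
      adj k (colour q u) (colour q w)
    ∎
    where open ≡-Reasoning

  lc-graphOf : ∀ {k k′} p v → Step k (colour p v) k′ → lc v (graphOf k p) ≐ graphOf k′ p
  lc-graphOf {k} {k′} p v (step loopless complements) = lc-colourGraph {c = colour p} {adj k} {adj k′} v loopless
    λ u≢w → complements _ _ (colour-realisable p u≢w)

  lc-graphOf-lcKind : ∀ k p v → ∃ λ q → lc v (graphOf k p) ≐ graphOf (lcKind k (colour p v)) q
  lc-graphOf-lcKind k p v = at (colour p v) refl
    where
    Result : Kind → Set
    Result k′ = ∃ λ q → lc v (graphOf k p) ≐ graphOf k′ q
    at-anchor : ∀ {z} q → graphOf k p ≐ graphOf k q → colour q v ≡ z → singleton z ≡ true →
      Result (lcKind k z)
    at-anchor {z} q p≐q eq single = q , ≐-trans (lc-cong v p≐q)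
      (lc-graphOf q v (subst (λ x → Step k x (lcKind k z)) (sym eq) (anchor-steps k z single)))
    directly : ∀ {z} → colour p v ≡ z → Step k z (lcKind k z) → Result (lcKind k z)
    directly {z} eq s = p , lc-graphOf p v (subst (λ x → Step k x (lcKind k z)) (sym eq) s)
    at : ∀ z → colour p v ≡ z → Result (lcKind k z)
    at α  eq = at-anchor p (λ _ _ → refl) eq refl
    at β  eq = at-anchor p (λ _ _ → refl) eq refl
    at A′ eq with A′-steps k
    ... | inj₂ s = directly eq s
    ... | inj₁ (blindA , same) =
      subst Result (sym same) (at-anchor q (reanchor p q blindA merged) (colour-a q) refl)
      where
      q = moveA p v (trans (sym (isA-colour p v)) (cong isA eq))
      merged : ∀ u → mergeA (colour p u) ≡ mergeA (colour q u)
      merged u = trans (mergeA-colour p u) (sym (mergeA-colour q u))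
    at B′ eq with B′-steps k
    ... | inj₂ s = directly eq s
    ... | inj₁ (blindB , same) =
      subst Result (sym same) (at-anchor q (reanchor p q blindB merged) (colour-b q) refl)
      where
      q = moveB p v (trans (sym (isA-colour p v)) (cong isA eq))
      merged : ∀ u → mergeB (colour p u) ≡ mergeB (colour q u)
      merged u = trans (mergeB-colour p u) (sym (mergeB-colour q u))

  K≐graphOf : ∀ p → K n m ≐ graphOf complete p
  K≐graphOf p u w with u ≟ w
  ... | yes refl = no-loop (side u)
    where
    no-loop : ∀ s → ((not s ∧ s) ∨ (s ∧ not s)) ≡ false
    no-loop true  = refl
    no-loop false = refl
  ... | no u≢w = begin
      (not (side u) ∧ side w) ∨ (side u ∧ not (side w))
    ≡⟨ bipartite (side u) (side w) ⟩
      side u xor side w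
    ≡⟨ cong₂ _xor_ (sym (isA-colour p u)) (sym (isA-colour p w)) ⟩
      edge complete (colour p u) (colour p w)
    ≡⟨ cong (_∧ edge complete (colour p u) (colour p w)) (sym (colour-realisable p u≢w)) ⟩
      adj complete (colour p u) (colour p w)
    ∎
    where
    open ≡-Reasoning
    bipartite : ∀ s t → ((not s ∧ t) ∨ (s ∧ not t)) ≡ s xor t
    bipartite true  true  = refl
    bipartite true  false = refl
    bipartite false true  = refl
    bipartite false false = refl

  orbit-graphOf : Anchors → ∀ {H} → InOrbit (K n m) H → ∃ λ k → ∃ λ p → H ≐ graphOf k p
  orbit-graphOf p₀ (vs , lcs≐H) =
    let (k , p , G≐graph) = along vs in k , p , ≐-trans (≐-sym lcs≐H) G≐graph
    where
    along : ∀ vs → ∃ λ k → ∃ λ p → lcs vs (K n m) ≐ graphOf k p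
    along []       = complete , p₀ , K≐graphOf p₀
    along (v ∷ vs) = let (k , p , G≐graph) = along vs ; (q , lc≐graph) = lc-graphOf-lcKind k p v
                     in lcKind k (colour p v) , q , ≐-trans (lc-cong v G≐graph) lc≐graph

  colour-permute : (π : Permutation′ (n + m)) {p q : Anchors} →
    π ⟨$⟩ʳ a p ≡ a q → π ⟨$⟩ʳ b p ≡ b q → (∀ u → side (π ⟨$⟩ʳ u) ≡ side u) →
    ∀ u → colour q (π ⟨$⟩ʳ u) ≡ colour p u
  colour-permute π {p} {q} πa πb πside u with u ≟ a p
  ... | yes refl = trans (cong (colour q) πa) (colour-a q)
  ... | no u≢a with u ≟ b p
  ...   | yes refl = trans (cong (colour q) πb) (colour-b q)
  ...   | no u≢b = trans (colour-other q (u≢a ∘ moved πa) (u≢b ∘ moved πb)) (cong sideClass (πside u))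
    where
    moved : ∀ {x y} → π ⟨$⟩ʳ x ≡ y → π ⟨$⟩ʳ u ≡ y → u ≡ x
    moved πx≡y πu≡y = Injection.injective (↔⇒↣ π) (trans πu≡y (sym πx≡y))

  relabel : ∀ k p q → graphOf k p ≅ graphOf k q
  relabel k p q = colourGraph-≅ {c = colour p} {colour q} {adj k} {adj k} π (λ x → x)
    (colour-permute π {p} {q} πa πb πside) (λ _ _ → refl)
    where
    π = Perm.transpose (a p) (a q) ∘ₚ Perm.transpose (b p) (b q)
    πa : π ⟨$⟩ʳ a p ≡ a q
    πa = trans (cong (Perm.transpose (b p) (b q) ⟨$⟩ʳ_) (transpose-source (a p) (a q)))
               (transpose-other (sides-differ (a∈A q) (b∈B p)) (sides-differ (a∈A q) (b∈B q)))
    πb : π ⟨$⟩ʳ b p ≡ b q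
    πb = trans (cong (Perm.transpose (b p) (b q) ⟨$⟩ʳ_)
                     (transpose-other (sides-differ (a∈A p) (b∈B p) ∘ sym)
                                      (sides-differ (a∈A q) (b∈B p) ∘ sym)))
               (transpose-source (b p) (b q))
    πside : ∀ u → side (π ⟨$⟩ʳ u) ≡ side u
    πside u = trans (transpose-preserves side (trans (b∈B p) (sym (b∈B q))) _)
                    (transpose-preserves side (trans (a∈A p) (sym (a∈A q))) u)

module Mirror (n : ℕ) where
  open Bipartition n n
  open Anchors

  swapSides : Permutation′ (n + n)
  swapSides = ↔-trans (+↔⊎ {n} {n}) (↔-trans swap-↔ (↔-sym +↔⊎))

  side-swapSides : ∀ u → side (swapSides ⟨$⟩ʳ u) ≡ not (side u)
  side-swapSides u with splitAt n u in eq
  ... | inj₁ i = trans (side-↑ʳ i) (cong not (trans (sym (side-↑ˡ i)) (cong side (splitAt⁻¹-↑ˡ eq))))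
  ... | inj₂ j = trans (side-↑ˡ j) (cong not (trans (sym (side-↑ʳ j)) (cong side (splitAt⁻¹-↑ʳ eq))))

  mirrorAnchors : Anchors → Anchors
  mirrorAnchors p = anchors (swapSides ⟨$⟩ʳ b p) (swapSides ⟨$⟩ʳ a p)
    (trans (side-swapSides (b p)) (cong not (b∈B p))) (trans (side-swapSides (a p)) (cong not (a∈A p)))

  colour-mirror : ∀ p u → colour (mirrorAnchors p) (swapSides ⟨$⟩ʳ u) ≡ mirrorClass (colour p u)
  colour-mirror p u with u ≟ a p
  ... | yes refl = colour-b (mirrorAnchors p)
  ... | no u≢a with u ≟ b p
  ...   | yes refl = colour-a (mirrorAnchors p)
  ...   | no u≢b = begin
      colour (mirrorAnchors p) (swapSides ⟨$⟩ʳ u)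
    ≡⟨ colour-other (mirrorAnchors p) (u≢b ∘ injective) (u≢a ∘ injective) ⟩
      sideClass (side (swapSides ⟨$⟩ʳ u))
    ≡⟨ cong sideClass (side-swapSides u) ⟩
      sideClass (not (side u))
    ≡⟨ sideClass-not (side u) ⟩
      mirrorClass (sideClass (side u))
    ∎
    where
    open ≡-Reasoning
    injective = Injection.injective (↔⇒↣ swapSides)
    sideClass-not : ∀ s → sideClass (not s) ≡ mirrorClass (sideClass s)
    sideClass-not true  = refl
    sideClass-not false = refl

  mirror-≅ : ∀ k p → graphOf k p ≅ graphOf (mirror k) (mirrorAnchors p)
  mirror-≅ k p = colourGraph-≅ {c = colour p} {colour (mirrorAnchors p)} {adj k} {adj (mirror k)}
    swapSides mirrorClass (colour-mirror p) (mirror-adj k)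

-- The six representatives and the invariants that separate them

module Representatives (n′ m′ : ℕ) where
  n m : ℕ
  n = 2 + n′
  m = 2 + m′

  open Bipartition n m

  first second : ∀ {k} → Fin (2 + k)
  first  = zero
  second = suc zero

  a₀ a₁ b₀ b₁ : Fin (n + m)
  a₀ = first ↑ˡ m
  a₁ = second ↑ˡ m
  b₀ = n ↑ʳ first
  b₁ = n ↑ʳ second

  p₀ : Anchors
  p₀ = anchors a₀ b₀ (side-↑ˡ first) (side-↑ʳ first)

  rep : Kind → Graph (n + m)
  rep k = graphOf k p₀

  col : Fin (n + m) → Class
  col = colour p₀

  witness : Class → Fin (n + m)
  witness α  = a₀
  witness β  = b₀
  witness A′ = a₁
  witness B′ = b₁

  col-witness : ∀ x → col (witness x) ≡ x
  col-witness α  = colour-a p₀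
  col-witness β  = colour-b p₀
  col-witness A′ = trans (colour-other p₀ {a₁} (λ ()) (sides-differ (side-↑ˡ second) (side-↑ʳ first)))
                         (cong sideClass (side-↑ˡ second))
  col-witness B′ = trans (colour-other p₀ {b₁} (sides-differ (side-↑ˡ first) (side-↑ʳ second) ∘ sym)
                                          (λ e → case ↑ʳ-injective n second first e of λ ()))
                         (cong sideClass (side-↑ʳ second))

  witness-≢ : ∀ {x u} → x ≢ col u → u ≢ witness x
  witness-≢ {x} x≢cu refl = x≢cu (sym (col-witness x))

  rep-witness : ∀ k {u} y → col u ≢ y → rep k u (witness y) ≡ adj k (col u) y
  rep-witness k {u} y cu≢y = trans (colourGraph-off {c = col} {adj k} (witness-≢ {y} {u} (cu≢y ∘ sym)))
                                   (cong (adj k (col u)) (col-witness y))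

  rep-witnesses : ∀ k {x y} → x ≢ y → rep k (witness x) (witness y) ≡ adj k x y
  rep-witnesses k {x} {y} x≢y = trans (rep-witness k {witness x} y (subst (_≢ y) (sym (col-witness x)) x≢y))
                                      (cong (λ z → adj k z y) (col-witness x))

  -- Local complementation is applied from the end of the list.
  route : Kind → List Class
  route complete   = []
  route splitA     = β ∷ []
  route splitB     = α ∷ []
  route coneA      = α ∷ β ∷ []
  route coneB      = β ∷ α ∷ []
  route doubleStar = α ∷ β ∷ α ∷ []

  run : List Class → Kind
  run = foldr (λ z k → lcKind k z) complete

  opaque
    route-valid : ∀ k → All (λ z → singleton z ≡ true) (route k) × run (route k) ≡ k
    route-valid = from-yes (all? λ k →
      All.all? (λ z → singleton z Bool.≟ true) (route k) ×-dec (run (route k) ≟ k))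

  follow : ∀ zs → All (λ z → singleton z ≡ true) zs → lcs (map witness zs) (K n m) ≐ rep (run zs)
  follow []       []                  = K≐graphOf p₀
  follow (z ∷ zs) (single ∷ singles) = ≐-trans (lc-cong (witness z) (follow zs singles))
    (lc-graphOf p₀ (witness z) (subst (λ x → Step (run zs) x (lcKind (run zs) z)) (sym (col-witness z))
                                      (anchor-steps (run zs) z single)))

  rep∈orbit : ∀ k → InOrbit (K n m) (rep k)
  rep∈orbit k = let (singles , reaches) = route-valid k in map witness (route k) ,
    subst (λ k′ → lcs (map witness (route k)) (K n m) ≐ rep k′) reaches (follow (route k) singles)

  orbit-covered : ∀ H → InOrbit (K n m) H → ∃ λ k → H ≅ rep k
  orbit-covered H H∈orbit = let (k , p , H≐graph) = orbit-graphOf p₀ H∈orbit in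
    k , ≅-trans {G = H} {graphOf k p} {rep k} (≐⇒≅ H≐graph) (relabel k p p₀)

  module _ {P : Fin (n + m) → Set} {Q : Class → Set} (by-class : ∀ u → P u ⇔ Q (col u)) where

    ∃-by-class : ∃ P ⇔ ∃ Q
    ∃-by-class = mk⇔ (λ (u , p) → col u , Equivalence.to (by-class u) p)
      (λ (x , q) → witness x , Equivalence.from (by-class (witness x)) (subst Q (sym (col-witness x)) q))

    side-by-class : ∀ {s} → (∀ x → Q x ⇔ isA x ≡ s) → ∀ u → P u ⇔ side u ≡ s
    side-by-class {s} Q⇔ u = subst (λ t → P u ⇔ t ≡ s) (isA-colour p₀ u) (Q⇔ (col u) ⇔-∘ by-class u)

  universal-by-class : ∀ k u → Universal (rep k) u ⇔ UniversalClass k (col u)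
  universal-by-class k u = mk⇔ to from
    where
    to : Universal (rep k) u → UniversalClass k (col u)
    to U y cu≢y = trans (sym (rep-witness k {u} y cu≢y)) (U (witness y) (witness-≢ {y} {u} (cu≢y ∘ sym)))
    from : UniversalClass k (col u) → Universal (rep k) u
    from U w u≢w = trans (colourGraph-off {c = col} {adj k} u≢w) (adjacent (col u ≟ col w))
      where
      adjacent : Dec (col u ≡ col w) → adj k (col u) (col w) ≡ true
      adjacent (no cu≢cw)  = U (col w) cu≢cw
      adjacent (yes cu≡cw) = subst (λ y → adj k (col u) y ≡ true) cu≡cw (universal-closed k (col u) U
        (subst (λ y → realisable (col u) y ≡ true) (sym cu≡cw) (colour-realisable p₀ u≢w)))

  inner-by-class : ∀ k u → OnInnerEdge (rep k) u ⇔ InnerClass k (col u)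
  inner-by-class k u = mk⇔ to from
    where
    universal = universal-by-class k
    to : OnInnerEdge (rep k) u → InnerClass k (col u)
    to (¬U , w , uw , ¬Uw) = ¬U ∘ Equivalence.from (universal u) ,
      col w , proj₂ (colourGraph-edge {c = col} {adj k} {u} {w} uw) , ¬Uw ∘ Equivalence.from (universal w)
    from : InnerClass k (col u) → OnInnerEdge (rep k) u
    from inner@(¬U , _) = let (y , cu≢y , uy , ¬Uy) = inner-distinct k (col u) inner in
      ¬U ∘ Equivalence.to (universal u) , witness y , trans (rep-witness k {u} y cu≢y) uy ,
      λ U → ¬Uy (subst (UniversalClass k) (col-witness y) (Equivalence.to (universal (witness y)) U))

  ∃-class-invariant : ∀ {P : Graph (n + m) → Fin (n + m) → Set} {Q : Kind → Class → Set} →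
    Invariant P → (∀ k u → P (rep k) u ⇔ Q k (col u)) →
    ∀ {k k′} → rep k ≅ rep k′ → ∃ (Q k) ⇔ ∃ (Q k′)
  ∃-class-invariant {P} {Q} invariant by-class {k} {k′} iso =
    ∃-by-class {P (rep k′)} {Q k′} (by-class k′) ⇔-∘
      (∃-invariant invariant {rep k} {rep k′} iso ⇔-∘ ⇔-sym (∃-by-class {P (rep k)} {Q k} (by-class k)))

  profile-invariant : ∀ {k k′} → rep k ≅ rep k′ → profile k ≡ profile k′
  profile-invariant {k} {k′} iso = cong₂ _,_
    (does-⇔ (∃-class-invariant {Q = UniversalClass} universal-invariant universal-by-class {k} {k′} iso)
            (any? (universal? k)) (any? (universal? k′)))
    (does-⇔ (∃-class-invariant {Q = InnerClass} onInnerEdge-invariant inner-by-class {k} {k′} iso)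
            (any? (inner? k)) (any? (inner? k′)))

  marked-sides⇒n≡m : ∀ {P} → Invariant P → ∀ {k k′} s →
    (∀ u → P (rep k) u ⇔ side u ≡ s) → (∀ u → P (rep k′) u ⇔ side u ≡ not s) →
    rep k ≅ rep k′ → n ≡ m
  marked-sides⇒n≡m invariant {k} {k′} s marks marks′ iso = sides-swapped⇒n≡m π λ u →
    flipped (side u) (side (π ⟨$⟩ʳ u)) s
      (marks u ⇔-∘ (⇔-sym (invariant-⇔ invariant {rep k} {rep k′} iso u) ⇔-∘
                    ⇔-sym (marks′ (π ⟨$⟩ʳ u))))
    where
    π = proj₁ iso
    flipped : ∀ x y s → (y ≡ not s ⇔ x ≡ s) → y ≡ not x
    flipped false y     false e = Equivalence.from e refl
    flipped true  y     true  e = Equivalence.from e refl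
    flipped true  false false e = refl
    flipped false true  true  e = refl
    flipped true  true  false e with Equivalence.to e refl
    ... | ()
    flipped false false true  e with Equivalence.to e refl
    ... | ()

  mirror-≅⇒n≡m : ∀ k → mirror k ≢ k → rep k ≅ rep (mirror k) → n ≡ m
  mirror-≅⇒n≡m complete   mirrored = ⊥-elim (mirrored refl)
  mirror-≅⇒n≡m splitA     _ = marked-sides⇒n≡m universal-invariant {splitA} {splitB} true
    (side-by-class (universal-by-class splitA) universal-splitA)
    (side-by-class (universal-by-class splitB) universal-splitB)
  mirror-≅⇒n≡m splitB     _ = marked-sides⇒n≡m universal-invariant {splitB} {splitA} false
    (side-by-class (universal-by-class splitB) universal-splitB)
    (side-by-class (universal-by-class splitA) universal-splitA)
  mirror-≅⇒n≡m coneA      _ = marked-sides⇒n≡m onInnerEdge-invariant {coneA} {coneB} false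
    (side-by-class (inner-by-class coneA) inner-coneA) (side-by-class (inner-by-class coneB) inner-coneB)
  mirror-≅⇒n≡m coneB      _ = marked-sides⇒n≡m onInnerEdge-invariant {coneB} {coneA} true
    (side-by-class (inner-by-class coneB) inner-coneB) (side-by-class (inner-by-class coneA) inner-coneA)
  mirror-≅⇒n≡m doubleStar mirrored = ⊥-elim (mirrored refl)

  doubleStar-leaf : Leaf (rep doubleStar) a₁
  doubleStar-leaf = a₀ , rep-witnesses doubleStar {A′} {α} (λ ()) , λ x a₁x →
    colour≡α p₀ (doubleStar-A′-neighbours (col x)
      (subst (λ z → adj doubleStar z (col x) ≡ true) (col-witness A′)
             (proj₂ (colourGraph-edge {c = col} {adj doubleStar} {a₁} {x} a₁x))))

  complete-leafless : ¬ ∃ (Leaf (rep complete))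
  complete-leafless (u , w , _ , unique) =
    let (y , z , y≢z , cu≢y , cu≢z , uy , uz) = complete-two-neighbours (col u) in y≢z (begin
      y                ≡⟨ sym (col-witness y) ⟩
      col (witness y)  ≡⟨ cong col (trans (neighbour y cu≢y uy) (sym (neighbour z cu≢z uz))) ⟩
      col (witness z)  ≡⟨ col-witness z ⟩
      z                ∎)
    where
    open ≡-Reasoning
    neighbour : ∀ y → col u ≢ y → adj complete (col u) y ≡ true → witness y ≡ w
    neighbour y cu≢y uy = unique (witness y) (trans (rep-witness complete {u} y cu≢y) uy)

  separate : ∀ {k k′} → rep k ≅ rep k′ → k′ ≡ k ⊎ (k′ ≡ mirror k × n ≡ m)
  separate {k} {k′} iso = by-profile iso (same-profile k k′ (profile-invariant {k} {k′} iso))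
    where
    by-profile : ∀ {k k′} → rep k ≅ rep k′ → k′ ≡ k ⊎ Lookalike k k′ →
      k′ ≡ k ⊎ (k′ ≡ mirror k × n ≡ m)
    by-profile iso (inj₁ same) = inj₁ same
    by-profile {k} iso (inj₂ (inj₁ (refl , mirrored))) = inj₂ (refl , mirror-≅⇒n≡m k mirrored iso)
    by-profile iso (inj₂ (inj₂ (inj₁ (refl , refl)))) = ⊥-elim (complete-leafless
      (Equivalence.from (∃-invariant leaf-invariant {rep complete} {rep doubleStar} iso) (a₁ , doubleStar-leaf)))
    by-profile iso (inj₂ (inj₂ (inj₂ (refl , refl)))) = ⊥-elim (complete-leafless
      (Equivalence.to (∃-invariant leaf-invariant {rep doubleStar} {rep complete} iso) (a₁ , doubleStar-leaf)))

  six-classes : n ≢ m → NumIsoClasses (InOrbit (K n m)) 6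
  six-classes n≢m = rep , rep∈orbit , separated , orbit-covered
    where
    separated : ∀ k k′ → rep k ≅ rep k′ → k ≡ k′
    separated k k′ iso = [ sym , ⊥-elim ∘ n≢m ∘ proj₂ ]′ (separate {k} {k′} iso)

module Balanced (n′ : ℕ) where
  open Representatives n′ n′
  open Bipartition n n using (graphOf; relabel)
  open Mirror n using (mirrorAnchors; mirror-≅)

  rep-mirror : ∀ k → rep k ≅ rep (mirror k)
  rep-mirror k = ≅-trans {G = rep k} {graphOf (mirror k) (mirrorAnchors p₀)} {rep (mirror k)}
    (mirror-≅ k p₀) (relabel (mirror k) (mirrorAnchors p₀) p₀)

  to-balanced : ∀ {k} → (∃ λ i → k ≡ balanced i ⊎ mirror k ≡ balanced i) →
    ∃ λ i → rep k ≅ rep (balanced i)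
  to-balanced     (i , inj₁ refl) = i , ≐⇒≅ (λ _ _ → refl)
  to-balanced {k} (i , inj₂ mk≡i) = i , subst (λ k′ → rep k ≅ rep k′) mk≡i (rep-mirror k)

  four-classes : NumIsoClasses (InOrbit (K n n)) 4
  four-classes = rep ∘ balanced , rep∈orbit ∘ balanced , separated , covered
    where
    separated : ∀ i j → rep (balanced i) ≅ rep (balanced j) → i ≡ j
    separated i j iso = balanced-separated i j (map₂ proj₁ (separate {balanced i} {balanced j} iso))
    covered : ∀ H → InOrbit (K n n) H → ∃ λ i → H ≅ rep (balanced i)
    covered H H∈orbit =
      let (k , H≅rep) = orbit-covered H H∈orbit ; (i , rep≅rep) = to-balanced (balanced-covers k)
      in i , ≅-trans {G = H} {rep k} {rep (balanced i)} H≅rep rep≅rep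

theorem6 : ∀ n m → n ≥ 2 → m ≥ 2 →
    (n ≢ m → NumIsoClasses (InOrbit (K n m)) 6) ×
    (n ≡ m → NumIsoClasses (InOrbit (K n m)) 4)
theorem6 (suc (suc n′)) (suc (suc m′)) (s≤s (s≤s z≤n)) (s≤s (s≤s z≤n)) =
  Representatives.six-classes n′ m′ , λ { refl → Balanced.four-classes n′ }
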